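{- Let $W$ be a circular binary word, and for a binary word $U$ let $|W|_U$ denote the number of occurrences of $U$ in $W$. Then \[ |W|_{0011}-|W|_{1100} \;=\; |W|_{1101}-|W|_{1011} \;=\; |W|_{1010}-|W|_{0101} \;=\; |W|_{0100}-|W|_{0010}. \]
   Context: A circular binary word of length $n$ is a word $W=W_0W_1\ldots W_{n-1}$ over the alphabet $\{0,1\}$ whose indices are taken in the cyclic group $\mathbb{Z}/n\mathbb{Z}$. A word $U=U_0\ldots U_{k-1}$ with $k\le n$ occurs in $W$ at position $i\in\mathbb{Z}/n\mathbb{Z}$ if $U_j=W_{i+j}$ (indices mod $n$) for all $0\le j\le k-1$; $|W|_U$ is the number of positions $i\in\mathbb{Z}/n\mathbb{Z}$ at which $U$ occurs in $W$. For example, the circular word $0001$ has an occurrence of $010$ at position $2$, and $|00101|_{010}=2$. -}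

module Defs where

open import Data.Bool using (Bool; true; false)
open import Data.Nat using (ℕ; zero; suc; _+_; _≤_; _≤?_)
open import Data.Nat.DivMod using (_mod_)
open import Data.Fin using (Fin; toℕ)
open import Data.Vec using (Vec; lookup)
open import Data.List using (List; length; lookup; allFin; filter)
open import Data.Product using (_×_; _,_)
open import Relation.Nullary using (Dec; yes; no)
open import Relation.Nullary.Decidable using (⌊_⌋)
open import Relation.Binary.PropositionalEquality using (_≡_)
import Data.Bool.Properties as BP
open import Data.Fin.Properties using (all?)

-- Letter W_{i+j} (indices mod n).  Needs n nonzero, supplied by i : Fin n.
letterAt : ∀ {n} → Vec Bool n → Fin n → ℕ → Bool
letterAt {suc n} W i j = Data.Vec.lookup W ((toℕ i + j) mod (suc n))

-- U occurs in W at position i : U_j = W_{i+j} for all 0 ≤ j < |U|,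
-- and |U| ≤ n as required by the definition.
OccursAt : ∀ {n} → List Bool → Vec Bool n → Fin n → Set
OccursAt {n} U W i =
  (length U ≤ n) × ((j : Fin (length U)) → Data.List.lookup U j ≡ letterAt W i (toℕ j))

occursAt? : ∀ {n} (U : List Bool) (W : Vec Bool n) (i : Fin n) → Dec (OccursAt U W i)
occursAt? {n} U W i with length U ≤? n
... | no ¬p = no (λ { (p , _) → ¬p p })
... | yes p with all? (λ j → Data.List.lookup U j BP.≟ letterAt W i (toℕ j))
...   | yes q = yes (p , q)
...   | no ¬q = no (λ { (_ , q) → ¬q q })

count : ∀ {n} → Vec Bool n → List Bool → ℕ
count {n} W U = length (filter (occursAt? U W) (allFin n))

-- Counting positions by what precedes or what follows them, every circular
-- word V with |V| < n satisfies the balance law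
--   |W|_{0V} + |W|_{1V} = |W|_V = |W|_{V0} + |W|_{V1}.
-- The second and third identities are the balance laws for V = 101 and
-- V = 010; the first combines those for V = 011, 110 and 111.
module Submission where

open import Defs
open import Data.Bool using (Bool; true; false; _∧_)
open import Data.Bool.Properties using (_≟_; ∧-assoc; ∧-identityʳ)
open import Data.Nat using (ℕ; zero; suc; _+_; _%_; _≤_; _<_; _≤?_; s≤s; z≤n)
open import Data.Nat.Properties
  using (+-comm; +-assoc; +-suc; +-cancelʳ-≡; +-commutativeSemigroup; <⇒≤; ≤-trans; ≤-reflexive)
open import Data.Nat.DivMod using (_mod_; [m+n]%n≡m%n)
open import Algebra.Properties.CommutativeSemigroup +-commutativeSemigroup
  using () renaming (interchange to +-interchange)
open import Data.Fin using (Fin; toℕ)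
open import Data.Fin.Properties using (all?; toℕ-injective; toℕ-fromℕ<)
open import Data.Vec as Vec using (Vec)
open import Data.List using (List; _∷_; []; _∷ʳ_; length; lookup; filter; tabulate)
open import Data.List.Properties using (length-++)
open import Data.Integer using (+_; _-_)
import Data.Integer as ℤ
open import Data.Integer.Tactic.RingSolver using (solve-∀)
open import Data.Product using (_×_; _,_)
open import Function using (_∘_)
open import Relation.Nullary using (Dec; yes; no; does; contradiction)
open import Relation.Binary.PropositionalEquality
  using (_≡_; refl; sym; trans; cong; cong₂; module ≡-Reasoning)

open ≡-Reasoning

ι : Bool → ℕ
ι true  = 1
ι false = 0

∑ : ℕ → (ℕ → ℕ) → ℕ
∑ zero    f = 0
∑ (suc n) f = f 0 + ∑ n (f ∘ suc)

syntax ∑ n (λ k → e) = ∑[ k < n ] e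

∑-cong : ∀ n {f g : ℕ → ℕ} → (∀ k → f k ≡ g k) → ∑ n f ≡ ∑ n g
∑-cong zero    f≗g = refl
∑-cong (suc n) f≗g = cong₂ _+_ (f≗g 0) (∑-cong n (f≗g ∘ suc))

∑-distrib-+ : ∀ n (f g : ℕ → ℕ) → ∑[ k < n ] (f k + g k) ≡ ∑ n f + ∑ n g
∑-distrib-+ zero    f g = refl
∑-distrib-+ (suc n) f g = begin
  (f 0 + g 0) + ∑[ k < n ] (f (suc k) + g (suc k))
    ≡⟨ cong (λ t → (f 0 + g 0) + t) (∑-distrib-+ n (f ∘ suc) (g ∘ suc)) ⟩
  (f 0 + g 0) + (∑ n (f ∘ suc) + ∑ n (g ∘ suc))
    ≡⟨ +-interchange (f 0) (g 0) _ _ ⟩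
  (f 0 + ∑ n (f ∘ suc)) + (g 0 + ∑ n (g ∘ suc)) ∎

∑-last : ∀ n (f : ℕ → ℕ) → ∑ (suc n) f ≡ ∑ n f + f n
∑-last zero    f = +-comm (f 0) 0
∑-last (suc n) f = begin
  f 0 + ∑ (suc n) (f ∘ suc)         ≡⟨ cong (λ t → f 0 + t) (∑-last n (f ∘ suc)) ⟩
  f 0 + (∑ n (f ∘ suc) + f (suc n)) ≡⟨ +-assoc (f 0) _ _ ⟨
  ∑ (suc n) f + f (suc n)           ∎

∑-rotate : ∀ n (f : ℕ → ℕ) → f n ≡ f 0 → ∑ n (f ∘ suc) ≡ ∑ n f
∑-rotate n f fn≡f0 = +-cancelʳ-≡ (f 0) _ _ (begin
  ∑ n (f ∘ suc) + f 0 ≡⟨ +-comm _ (f 0) ⟩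
  ∑ (suc n) f         ≡⟨ ∑-last n f ⟩
  ∑ n f + f n         ≡⟨ cong (λ t → ∑ n f + t) fn≡f0 ⟩
  ∑ n f + f 0         ∎)

length-filter-tabulate : ∀ {A : Set} {P : A → Set} (P? : ∀ x → Dec (P x)) n
  (g : Fin n → A) (f : ℕ → ℕ) → (∀ i → ι (does (P? (g i))) ≡ f (toℕ i)) →
  length (filter P? (tabulate g)) ≡ ∑ n f
length-filter-tabulate P? zero    g f eq = refl
length-filter-tabulate P? (suc n) g f eq with does (P? (g Fin.zero)) | eq Fin.zero
... | true  | e = cong₂ _+_ e (length-filter-tabulate P? n (g ∘ Fin.suc) (f ∘ suc) (eq ∘ Fin.suc))
... | false | e = cong₂ _+_ e (length-filter-tabulate P? n (g ∘ Fin.suc) (f ∘ suc) (eq ∘ Fin.suc))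

matches : List Bool → (ℕ → Bool) → Bool
matches []      s = true
matches (b ∷ U) s = does (b ≟ s 0) ∧ matches U (s ∘ suc)

matches-cong : ∀ U {s t : ℕ → Bool} → (∀ j → s j ≡ t j) → matches U s ≡ matches U t
matches-cong []      s≗t = refl
matches-cong (b ∷ U) s≗t =
  cong₂ (λ x y → does (b ≟ x) ∧ y) (s≗t 0) (matches-cong U (s≗t ∘ suc))

matches-∷ʳ : ∀ U b (s : ℕ → Bool) →
  matches (U ∷ʳ b) s ≡ matches U s ∧ does (b ≟ s (length U))
matches-∷ʳ []      b s = ∧-identityʳ (does (b ≟ s 0))
matches-∷ʳ (a ∷ U) b s = trans
  (cong (does (a ≟ s 0) ∧_) (matches-∷ʳ U b (s ∘ suc)))
  (sym (∧-assoc (does (a ≟ s 0)) _ _))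

-- all? over Fin (suc n) reduces definitionally to a conjunction of the tests.
all?-lookup≡matches : ∀ U (s : ℕ → Bool) →
  does (all? (λ j → lookup U j ≟ s (toℕ j))) ≡ matches U s
all?-lookup≡matches []      s = refl
all?-lookup≡matches (b ∷ U) s = cong (does (b ≟ s 0) ∧_) (all?-lookup≡matches U (s ∘ suc))

occursAt?≡matches : ∀ {n} U (W : Vec Bool n) i → length U ≤ n →
  does (occursAt? U W i) ≡ matches U (letterAt W i)
occursAt?≡matches {n} U W i |U|≤n with length U ≤? n
... | no |U|≰n = contradiction |U|≤n |U|≰n
... | yes _ with all? (λ j → lookup U j ≟ letterAt W i (toℕ j)) in eq
...   | yes _ = trans (cong does (sym eq)) (all?-lookup≡matches U (letterAt W i))
...   | no _  = trans (cong does (sym eq)) (all?-lookup≡matches U (letterAt W i))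

ι-∧-splitʳ : ∀ p x → ι (p ∧ does (false ≟ x)) + ι (p ∧ does (true ≟ x)) ≡ ι p
ι-∧-splitʳ true  true  = refl
ι-∧-splitʳ true  false = refl
ι-∧-splitʳ false x     = refl

ι-∧-splitˡ : ∀ x p → ι (does (false ≟ x) ∧ p) + ι (does (true ≟ x) ∧ p) ≡ ι p
ι-∧-splitˡ true  true  = refl
ι-∧-splitˡ true  false = refl
ι-∧-splitˡ false true  = refl
ι-∧-splitˡ false false = refl

module _ {m : ℕ} (W : Vec Bool (suc m)) where

  cyclic : ℕ → Bool
  cyclic k = Vec.lookup W (k mod suc m)

  cyclic-periodic : ∀ k → cyclic (suc m + k) ≡ cyclic k
  cyclic-periodic k = cong (Vec.lookup W) (toℕ-injective (begin
    toℕ ((suc m + k) mod suc m) ≡⟨ toℕ-fromℕ< _ ⟩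
    (suc m + k) % suc m ≡⟨ cong (_% suc m) (+-comm (suc m) k) ⟩
    (k + suc m) % suc m ≡⟨ [m+n]%n≡m%n k (suc m) ⟩
    k % suc m           ≡⟨ toℕ-fromℕ< _ ⟨
    toℕ (k mod suc m)           ∎))

  occurrence : List Bool → ℕ → ℕ
  occurrence U k = ι (matches U (λ j → cyclic (k + j)))

  count≡∑occurrence : ∀ U → length U ≤ suc m → count W U ≡ ∑ (suc m) (occurrence U)
  count≡∑occurrence U |U|≤n = length-filter-tabulate (occursAt? U W) (suc m) (λ i → i)
    (occurrence U) (λ i → cong ι (occursAt?≡matches U W i |U|≤n))

  count-∷ʳ : ∀ U → length U < suc m →
    count W (U ∷ʳ false) + count W (U ∷ʳ true) ≡ count W U
  count-∷ʳ U |U|<n = begin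
    count W (U ∷ʳ false) + count W (U ∷ʳ true)
      ≡⟨ cong₂ _+_ (count≡∑occurrence (U ∷ʳ false) |U∷ʳb|≤n)
                   (count≡∑occurrence (U ∷ʳ true) |U∷ʳb|≤n) ⟩
    ∑ (suc m) (occurrence (U ∷ʳ false)) + ∑ (suc m) (occurrence (U ∷ʳ true))
      ≡⟨ ∑-distrib-+ (suc m) (occurrence (U ∷ʳ false)) (occurrence (U ∷ʳ true)) ⟨
    ∑[ k < suc m ] (occurrence (U ∷ʳ false) k + occurrence (U ∷ʳ true) k)
      ≡⟨ ∑-cong (suc m) split ⟩
    ∑ (suc m) (occurrence U)
      ≡⟨ count≡∑occurrence U (<⇒≤ |U|<n) ⟨
    count W U ∎
    where
    |U∷ʳb|≤n : ∀ {b} → length (U ∷ʳ b) ≤ suc m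
    |U∷ʳb|≤n = ≤-trans (≤-reflexive (trans (length-++ U) (+-comm _ 1))) |U|<n
    split : ∀ k → occurrence (U ∷ʳ false) k + occurrence (U ∷ʳ true) k ≡ occurrence U k
    split k rewrite matches-∷ʳ U false (λ j → cyclic (k + j))
                  | matches-∷ʳ U true  (λ j → cyclic (k + j)) =
      ι-∧-splitʳ (matches U (λ j → cyclic (k + j))) (cyclic (k + length U))

  -- An occurrence of bU at k is one of U at k + 1; by periodicity this shift
  -- does not change the total.
  count-∷ : ∀ U → length U < suc m →
    count W (false ∷ U) + count W (true ∷ U) ≡ count W U
  count-∷ U |U|<n = begin
    count W (false ∷ U) + count W (true ∷ U)
      ≡⟨ cong₂ _+_ (count≡∑occurrence (false ∷ U) |U|<n)
                   (count≡∑occurrence (true ∷ U) |U|<n) ⟩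
    ∑ (suc m) (occurrence (false ∷ U)) + ∑ (suc m) (occurrence (true ∷ U))
      ≡⟨ ∑-distrib-+ (suc m) (occurrence (false ∷ U)) (occurrence (true ∷ U)) ⟨
    ∑[ k < suc m ] (occurrence (false ∷ U) k + occurrence (true ∷ U) k)
      ≡⟨ ∑-cong (suc m) split ⟩
    ∑ (suc m) (occurrence U ∘ suc)
      ≡⟨ ∑-rotate (suc m) (occurrence U) (cong ι (matches-cong U cyclic-periodic)) ⟩
    ∑ (suc m) (occurrence U)
      ≡⟨ count≡∑occurrence U (<⇒≤ |U|<n) ⟨
    count W U ∎
    where
    split : ∀ k → occurrence (false ∷ U) k + occurrence (true ∷ U) k ≡ occurrence U (suc k)
    split k = trans
      (cong (λ p → ι (does (false ≟ cyclic (k + 0)) ∧ p) + ι (does (true ≟ cyclic (k + 0)) ∧ p))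
            (matches-cong U (λ j → cong cyclic (+-suc k j))))
      (ι-∧-splitˡ (cyclic (k + 0)) (matches U (λ j → cyclic (suc k + j))))

  balance : ∀ U → length U < suc m →
    count W (false ∷ U) + count W (true ∷ U) ≡ count W (U ∷ʳ false) + count W (U ∷ʳ true)
  balance U |U|<n = trans (count-∷ U |U|<n) (sym (count-∷ʳ U |U|<n))

[+a]-[+b]≡[+c]-[+d] : ∀ a b c d → a + d ≡ c + b → (+ a) - (+ b) ≡ (+ c) - (+ d)
[+a]-[+b]≡[+c]-[+d] a b c d a+d≡c+b = begin
  (+ a) - (+ b)                          ≡⟨ add-both (+ a) (+ b) (+ d) ⟩
  ((+ a) ℤ.+ (+ d)) - ((+ b) ℤ.+ (+ d)) ≡⟨ cong (λ t → (+ t) - ((+ b) ℤ.+ (+ d))) a+d≡c+b ⟩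
  ((+ c) ℤ.+ (+ b)) - ((+ b) ℤ.+ (+ d)) ≡⟨ cancel (+ c) (+ b) (+ d) ⟩
  (+ c) - (+ d)                          ∎
  where
  add-both : ∀ x y z → x - y ≡ (x ℤ.+ z) - (y ℤ.+ z)
  add-both = solve-∀
  cancel : ∀ x y z → (x ℤ.+ y) - (y ℤ.+ z) ≡ x - z
  cancel = solve-∀

mainTheorem1 : (n : ℕ) (W : Vec Bool n) →
    ((+ count W (false ∷ false ∷ true ∷ true ∷ [])) - (+ count W (true ∷ true ∷ false ∷ false ∷ []))
      ≡ (+ count W (true ∷ true ∷ false ∷ true ∷ [])) - (+ count W (true ∷ false ∷ true ∷ true ∷ [])))
    × ((+ count W (true ∷ true ∷ false ∷ true ∷ [])) - (+ count W (true ∷ false ∷ true ∷ true ∷ []))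
      ≡ (+ count W (true ∷ false ∷ true ∷ false ∷ [])) - (+ count W (false ∷ true ∷ false ∷ true ∷ [])))
    × ((+ count W (true ∷ false ∷ true ∷ false ∷ [])) - (+ count W (false ∷ true ∷ false ∷ true ∷ []))
      ≡ (+ count W (false ∷ true ∷ false ∷ false ∷ [])) - (+ count W (false ∷ false ∷ true ∷ false ∷ [])))
-- Below length 4 every count of a 4-letter word computes to 0.
mainTheorem1 0 W = refl , refl , refl
mainTheorem1 1 W = refl , refl , refl
mainTheorem1 2 W = refl , refl , refl
mainTheorem1 3 W = refl , refl , refl
mainTheorem1 (suc (suc (suc (suc k)))) W =
  [+a]-[+b]≡[+c]-[+d] (c (O ∷ O ∷ I ∷ I ∷ [])) (c (I ∷ I ∷ O ∷ O ∷ []))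
                      (c (I ∷ I ∷ O ∷ I ∷ [])) (c (I ∷ O ∷ I ∷ I ∷ [])) first ,
  [+a]-[+b]≡[+c]-[+d] (c (I ∷ I ∷ O ∷ I ∷ [])) (c (I ∷ O ∷ I ∷ I ∷ []))
                      (c (I ∷ O ∷ I ∷ O ∷ [])) (c (O ∷ I ∷ O ∷ I ∷ []))
    (trans (+-comm (c (I ∷ I ∷ O ∷ I ∷ [])) _) (balance W (I ∷ O ∷ I ∷ []) 3<n)) ,
  [+a]-[+b]≡[+c]-[+d] (c (I ∷ O ∷ I ∷ O ∷ [])) (c (O ∷ I ∷ O ∷ I ∷ []))
                      (c (O ∷ I ∷ O ∷ O ∷ [])) (c (O ∷ O ∷ I ∷ O ∷ []))
    (trans (+-comm (c (I ∷ O ∷ I ∷ O ∷ [])) _) (balance W (O ∷ I ∷ O ∷ []) 3<n))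
  where
  O I : Bool
  O = false
  I = true
  c : List Bool → ℕ
  c = count W
  3<n : 3 < 4 + k
  3<n = s≤s (s≤s (s≤s (s≤s z≤n)))
  first : c (O ∷ O ∷ I ∷ I ∷ []) + c (I ∷ O ∷ I ∷ I ∷ []) ≡ c (I ∷ I ∷ O ∷ I ∷ []) + c (I ∷ I ∷ O ∷ O ∷ [])
  first = begin
    c (O ∷ O ∷ I ∷ I ∷ []) + c (I ∷ O ∷ I ∷ I ∷ []) ≡⟨ balance W (O ∷ I ∷ I ∷ []) 3<n ⟩
    c (O ∷ I ∷ I ∷ O ∷ []) + c (O ∷ I ∷ I ∷ I ∷ []) ≡⟨ cong (λ t → c (O ∷ I ∷ I ∷ O ∷ []) + t) 0111≡1110 ⟩
    c (O ∷ I ∷ I ∷ O ∷ []) + c (I ∷ I ∷ I ∷ O ∷ []) ≡⟨ balance W (I ∷ I ∷ O ∷ []) 3<n ⟩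
    c (I ∷ I ∷ O ∷ O ∷ []) + c (I ∷ I ∷ O ∷ I ∷ []) ≡⟨ +-comm (c (I ∷ I ∷ O ∷ O ∷ [])) _ ⟩
    c (I ∷ I ∷ O ∷ I ∷ []) + c (I ∷ I ∷ O ∷ O ∷ []) ∎
    where
    0111≡1110 : c (O ∷ I ∷ I ∷ I ∷ []) ≡ c (I ∷ I ∷ I ∷ O ∷ [])
    0111≡1110 = +-cancelʳ-≡ (c (I ∷ I ∷ I ∷ I ∷ [])) _ _ (balance W (I ∷ I ∷ I ∷ []) 3<n)
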